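{- For every positive integer $n\equiv 0,6\pmod 8$, there exists an optimal $2$-D $(3\times n,3,1)$-OOC with $\Theta(3,0,n,3)=\left\lfloor\frac{9n-6}{6}\right\rfloor$ codewords.
   Context: Let $I_m=\{0,1,\dots,m-1\}$ and $\mathbb{Z}_n$ the integers modulo $n$. A $2$-D $(m\times n,k,1)$-OOC is a set $\mathcal{C}$ of $k$-subsets of $I_m\times\mathbb{Z}_n$ such that, for all $i,j\in I_m$, the multiset $\Delta_{ij}(\mathcal{C})=\bigcup_{B\in\mathcal{C}}\{x-y \bmod n:(i,x),(j,y)\in B,(i,x)\ne(j,y)\}$ contains every element of $\mathbb{Z}_n$ at most once. It is optimal if it has the largest possible number of codewords among all such codes. For $n$ even, $\Theta(m,r,n,k)=\left\lfloor\frac{(m^2-r^2)n-2(m-r)}{k(k-1)}\right\rfloor$. -}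

module Defs where

open import Data.Nat using (ℕ; _∸_; _+_; _*_; _≤_; _≤?_)
open import Data.Nat.DivMod using (_/_)
open import Data.Fin using (Fin; toℕ; _≟_)
open import Data.Product using (_×_; _,_; proj₁; proj₂; Σ)
open import Data.Product.Properties using (≡-dec)
open import Data.List using (List; []; _∷_; length; concatMap)
open import Data.List.Relation.Unary.Unique.Propositional using (Unique)
open import Data.List.Relation.Unary.AllPairs using (AllPairs)
open import Data.List.Relation.Unary.All using (All)
open import Data.List.Relation.Binary.Permutation.Propositional using (_↭_)
open import Relation.Nullary using (¬_; Dec; yes; no)
open import Relation.Binary.PropositionalEquality using (_≡_)

-- A point of I_m × ℤ_n : row index in Fin m, column in Fin n (ℤ_n ≅ {0..n-1}).
Point : ℕ → ℕ → Set
Point m n = Fin m × Fin n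

_≟ₚ_ : ∀ {m n} (p q : Point m n) → Dec (p ≡ q)
_≟ₚ_ = ≡-dec _≟_ _≟_

diffMod : ∀ {n} → Fin n → Fin n → ℕ
diffMod {n} x y with toℕ y ≤? toℕ x
... | yes _ = toℕ x ∸ toℕ y
... | no  _ = (toℕ x + n) ∸ toℕ y

-- A k-subset of I_m × ℤ_n, represented as a duplicate-free list of length k.
record Block (m n k : ℕ) : Set where
  constructor block
  field
    pts    : List (Point m n)
    unique : Unique pts
    size   : length pts ≡ k
open Block public

blockDiffs : ∀ {m n k} → Fin m → Fin m → Block m n k → List ℕ
blockDiffs {m} {n} i j B = concatMap (λ p → concatMap (λ q → pick p q) (pts B)) (pts B)
  where
  pick : Point m n → Point m n → List ℕ
  pick p q with p ≟ₚ q | proj₁ p ≟ i | proj₁ q ≟ j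
  ... | no _ | yes _ | yes _ = diffMod (proj₂ p) (proj₂ q) ∷ []
  ... | _    | _     | _     = []

Δ : ∀ {m n k} → Fin m → Fin m → List (Block m n k) → List ℕ
Δ i j C = concatMap (blockDiffs i j) C

-- A 2-D (m × n, k, 1)-OOC: a set of k-subsets (codewords pairwise distinct as sets)
-- such that every Δ_ij(C) contains each element of ℤ_n at most once.
record IsOOC (m n k : ℕ) (C : List (Block m n k)) : Set where
  field
    distinct : AllPairs (λ B B′ → ¬ (pts B ↭ pts B′)) C
    diffs    : ∀ (i j : Fin m) → Unique (Δ i j C)

∣_∣ᶜ : ∀ {m n k} → List (Block m n k) → ℕ
∣ C ∣ᶜ = length C

IsOptimalOOC : (m n k : ℕ) → List (Block m n k) → Set
IsOptimalOOC m n k C = IsOOC m n k C × (∀ (D : List (Block m n k)) → IsOOC m n k D → ∣ D ∣ᶜ ≤ ∣ C ∣ᶜ)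

Θ₃₀₃ : ℕ → ℕ
Θ₃₀₃ n = (9 * n ∸ 6) / 6

{-# OPTIONS --safe #-}
module Submission where

-- Upper bound: a codeword of size k contributes k(k−1) ordered differences, Δ_ij holds at most n
-- of them and Δ_ii at most n − 1 (points of a codeword are distinct, so 0 ∉ Δ_ii); for k = m = 3
-- this gives 6|C| + 3 ≤ 9n, i.e. |C| ≤ 3h − 1 = Θ(3,0,n,3) when n = 2h.
--
-- Construction: for n = 2h = G + 2g take two Skolem-type pairings P, Q of ℤ_n, i.e. h − 1 chords
-- covering ℤ_n ∖ {0, g} (resp. ℤ_n ∖ {0, G}) whose lengths, read either way round ℤ_n, cover
-- 1, …, h − 1. Every chord {x, y} of P gives the codewords {(0,x), (0,y), (1,0)} and
-- {(1,x), (1,y), (2,0)}, every chord of Q gives {(2,x), (2,y), (0,0)}, and the transversals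
-- {(0,0), (1,0), (2,0)} and {(0,0), (1,G+g), (2,G)} add the differences 0, g, g, G. Then every
-- Δ_ij covers ℤ_n, and Δ_ii covers ℤ_n ∖ {0, h}; as these 3h − 1 codewords have exactly 9n − 6
-- differences in total, no difference can occur twice. Suitable pairings exist for n ≡ 0, 6 (mod 8).

open import Defs
open import Data.Nat using (ℕ; _%_; _>_)
open import Data.Product using (Σ; _×_)
open import Data.Sum using (_⊎_)
open import Data.List using (List)
open import Relation.Binary.PropositionalEquality using (_≡_)

open import Data.Bool.Base using (if_then_else_)
open import Data.Empty using (⊥-elim)
open import Data.Fin as Fin using (Fin; toℕ; fromℕ<)
open import Data.Fin.Patterns using (0F; 1F; 2F)
open import Data.Fin.Properties using (toℕ-fromℕ<; toℕ<n; toℕ-injective)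
open import Data.List using ([]; _∷_; _++_; length; map; concat; concatMap; filter; downFrom; foldr)
open import Data.List.Properties using (filter-all; filter-notAll; length-++; length-map; length-downFrom; ++-identityʳ)
import Data.List.Properties as List
open import Data.List.Membership.Propositional using (_∈_; _∉_; find; lose)
open import Data.List.Membership.Propositional.Properties
  using (∈-++⁺ˡ; ∈-++⁺ʳ; ∈-map⁺; ∈-filter⁺; ∈-filter⁻; ∈-concatMap⁺; ∈-concatMap⁻;
         ∈-downFrom⁺; ∈-downFrom⁻)
open import Data.List.Relation.Binary.Permutation.Propositional using (_↭_)
open import Data.List.Relation.Binary.Permutation.Propositional.Properties using (∈-resp-↭)
open import Data.List.Relation.Binary.Subset.Propositional using (_⊆_)
import Data.List.Relation.Unary.All as All
open import Data.List.Relation.Unary.All.Properties using (¬Any⇒All¬)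
open import Data.List.Relation.Unary.AllPairs using (AllPairs)
open import Data.List.Relation.Unary.Any as Any using (Any; here; there)
open import Data.List.Relation.Unary.Any.Properties using (concat⁺)
open import Data.List.Relation.Unary.Unique.Propositional using (Unique)
open import Data.List.Relation.Unary.Unique.Propositional.Properties using (filter⁺; downFrom⁺)
open import Data.Nat using (zero; suc; _+_; _*_; _∸_; _≤_; _<_; _≤?_; _<?_; _≟_; z≤n; s≤s)
open import Data.Nat.DivMod using (_/_; m≡m%n+[m/n]*n; m*n/n≡m)
open import Data.Nat.Properties
open import Algebra.Properties.Semiring.Sum +-*-semiring
  using (sum-syntax; sum-cong-≗; sum-replicate-zero; ∑-distrib-+; *-distribˡ-sum)
open import Data.Nat.Tactic.RingSolver using (solve-∀; solve)
open import Data.Product using (_,_; proj₁; proj₂; ∃-syntax)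
open import Data.Sum using (inj₁; inj₂)
open import Function using (_∘_)
open import Relation.Binary.Definitions using (DecidableEquality; tri<; tri≈; tri>)
open import Relation.Binary.PropositionalEquality
  using (_≢_; refl; sym; trans; cong; cong₂; subst; subst₂; module ≡-Reasoning)
open import Relation.Nullary using (¬_; yes; no; does; ¬?)
open import Relation.Nullary.Negation using (contradiction)

-- The constructors of All and AllPairs are only opened locally: with them in scope the ring
-- solver's variable lists (r ∷ []) become ambiguous, which makes `solve` prohibitively slow.
module _ where
  open import Data.List.Relation.Unary.All using ([]; _∷_)
  open import Data.List.Relation.Unary.AllPairs using ([]; _∷_)

  module _ {A : Set} (_≟ᴬ_ : DecidableEquality A) where

    length-filter-≢ : ∀ x {xs} → Unique xs → length xs ≤ suc (length (filter (¬? ∘ (x ≟ᴬ_)) xs))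
    length-filter-≢ x {[]}     []           = z≤n
    length-filter-≢ x {y ∷ xs} (y∉xs ∷ xs!) with x ≟ᴬ y
    ... | yes refl = s≤s (≤-reflexive (cong length (sym (filter-all (¬? ∘ (x ≟ᴬ_)) y∉xs))))
    ... | no _     = s≤s (length-filter-≢ x xs!)

    length-filter-≢-∈ : ∀ {x xs} → Unique xs → x ∈ xs → suc (length (filter (¬? ∘ (x ≟ᴬ_)) xs)) ≡ length xs
    length-filter-≢-∈ {x} {xs} xs! x∈xs =
      ≤-antisym (filter-notAll (¬? ∘ (x ≟ᴬ_)) xs (Any.map contradiction x∈xs)) (length-filter-≢ x xs!)

    Unique-⊆⇒length≤ : ∀ {xs ys} → Unique xs → xs ⊆ ys → length xs ≤ length ys
    Unique-⊆⇒length≤ {[]}     _            _      = z≤n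
    Unique-⊆⇒length≤ {x ∷ xs} {ys} (x∉xs ∷ xs!) xs⊆ys = begin-strict
      length xs                            ≤⟨ Unique-⊆⇒length≤ xs! xs⊆ys-x ⟩
      length (filter (¬? ∘ (x ≟ᴬ_)) ys)    <⟨ filter-notAll (¬? ∘ (x ≟ᴬ_)) ys (Any.map contradiction (xs⊆ys (here refl))) ⟩
      length ys                            ∎
      where
      open ≤-Reasoning
      xs⊆ys-x : xs ⊆ filter (¬? ∘ (x ≟ᴬ_)) ys
      xs⊆ys-x y∈xs = ∈-filter⁺ (¬? ∘ (x ≟ᴬ_)) (xs⊆ys (there y∈xs)) (All.lookup x∉xs y∈xs)

    ⊆-length≤⇒Unique : ∀ {xs ys} → Unique ys → ys ⊆ xs → length xs ≤ length ys → Unique xs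
    ⊆-length≤⇒Unique {[]}     _    _       _       = []
    ⊆-length≤⇒Unique {x ∷ xs} {ys} ys! ys⊆x∷xs |x∷xs|≤ =
      ¬Any⇒All¬ xs x∉xs ∷ ⊆-length≤⇒Unique (filter⁺ (¬? ∘ (x ≟ᴬ_)) ys!) ys-x⊆xs
        (≤-pred (≤-trans |x∷xs|≤ (length-filter-≢ x ys!)))
      where
      x∉xs : x ∉ xs
      x∉xs x∈xs = n≮n _ (≤-trans |x∷xs|≤ (Unique-⊆⇒length≤ ys! ys⊆xs))
        where
        ys⊆xs : ys ⊆ xs
        ys⊆xs y∈ys with ys⊆x∷xs y∈ys
        ... | here refl  = x∈xs
        ... | there y∈xs = y∈xs
      ys-x⊆xs : filter (¬? ∘ (x ≟ᴬ_)) ys ⊆ xs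
      ys-x⊆xs y∈ys-x with ∈-filter⁻ (¬? ∘ (x ≟ᴬ_)) y∈ys-x
      ... | y∈ys , x≢y with ys⊆x∷xs y∈ys
      ...   | here y≡x   = ⊥-elim (x≢y (sym y≡x))
      ...   | there y∈xs = y∈xs

  module _ {A : Set} where

    Unique-++⁻ʳ : ∀ xs {ys : List A} → Unique (xs ++ ys) → Unique ys
    Unique-++⁻ʳ []       ys!           = ys!
    Unique-++⁻ʳ (x ∷ xs) (_ ∷ xs++ys!) = Unique-++⁻ʳ xs xs++ys!

    Unique-++⇒∉ : ∀ xs {ys : List A} {v} → Unique (xs ++ ys) → v ∈ xs → v ∉ ys
    Unique-++⇒∉ (x ∷ xs) (x∉ ∷ _)      (here refl)  v∈ys = All.lookup x∉ (∈-++⁺ʳ xs v∈ys) refl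
    Unique-++⇒∉ (x ∷ xs) (_ ∷ xs++ys!) (there v∈xs)      = Unique-++⇒∉ xs xs++ys! v∈xs

    Unique-triple : ∀ {a b c : A} → a ≢ b → a ≢ c → b ≢ c → Unique (a ∷ b ∷ c ∷ [])
    Unique-triple a≢b a≢c b≢c = (a≢b ∷ a≢c ∷ []) ∷ (b≢c ∷ []) ∷ [] ∷ []

  concatMap-≢⇒∃ : ∀ {A B : Set} → DecidableEquality B → (f g : A → List B) (xs : List A) →
                  concatMap f xs ≢ concatMap g xs → ∃[ x ] x ∈ xs × f x ≢ g x
  concatMap-≢⇒∃ _≟ᴮ_ f g []       fxs≢gxs = ⊥-elim (fxs≢gxs refl)
  concatMap-≢⇒∃ _≟ᴮ_ f g (x ∷ xs) fxs≢gxs with List.≡-dec _≟ᴮ_ (f x) (g x)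
  ... | no fx≢gx  = x , here refl , fx≢gx
  ... | yes fx≡gx with concatMap-≢⇒∃ _≟ᴮ_ f g xs (fxs≢gxs ∘ cong₂ _++_ fx≡gx)
  ...   | y , y∈xs , fy≢gy = y , there y∈xs , fy≢gy

  ∑-const : ∀ m c → ∑[ i < m ] c ≡ m * c
  ∑-const zero    c = refl
  ∑-const (suc m) c = cong (c +_) (∑-const m c)

  ∑-mono-≤ : ∀ {m} {f g : Fin m → ℕ} → (∀ i → f i ≤ g i) → ∑[ i < m ] f i ≤ ∑[ i < m ] g i
  ∑-mono-≤ {zero}  _   = z≤n
  ∑-mono-≤ {suc m} f≤g = +-mono-≤ (f≤g Fin.zero) (∑-mono-≤ (f≤g ∘ Fin.suc))

  ∑-tight : ∀ {m} (f g : Fin m → ℕ) → (∀ i → g i ≤ f i) → ∑[ i < m ] f i ≤ ∑[ i < m ] g i → ∀ i → f i ≤ g i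
  ∑-tight {suc m} f g g≤f ∑f≤∑g Fin.zero = +-cancelʳ-≤ _ (f Fin.zero) (g Fin.zero)
    (≤-trans ∑f≤∑g (+-monoʳ-≤ (g Fin.zero) (∑-mono-≤ (g≤f ∘ Fin.suc))))
  ∑-tight {suc m} f g g≤f ∑f≤∑g (Fin.suc i) = ∑-tight (f ∘ Fin.suc) (g ∘ Fin.suc) (g≤f ∘ Fin.suc)
    (+-cancelˡ-≤ (g Fin.zero) _ _ (≤-trans (+-monoˡ-≤ _ (g≤f Fin.zero)) ∑f≤∑g)) i

  δ : ∀ {m} → Fin m → Fin m → ℕ
  δ a i = if does (a Fin.≟ i) then 1 else 0

  ∑δ : ∀ {m} (a : Fin m) → ∑[ i < m ] δ a i ≡ 1
  ∑δ {suc m} Fin.zero    = cong suc (sum-replicate-zero m)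
  ∑δ {suc m} (Fin.suc a) = ∑δ a

  ∑∑ : ∀ {m} → (Fin m → Fin m → ℕ) → ℕ
  ∑∑ {m} f = ∑[ i < m ] ∑[ j < m ] f i j

  module _ {m : ℕ} where

    ∑∑-cong : ∀ {f g : Fin m → Fin m → ℕ} → (∀ i j → f i j ≡ g i j) → ∑∑ f ≡ ∑∑ g
    ∑∑-cong f≗g = sum-cong-≗ {m} (λ i → sum-cong-≗ {m} (f≗g i))

    ∑∑-const : ∀ c → ∑∑ {m} (λ _ _ → c) ≡ m * (m * c)
    ∑∑-const c = trans (sum-cong-≗ {m} (λ _ → ∑-const m c)) (∑-const m (m * c))

    ∑∑-zero : ∑∑ {m} (λ _ _ → 0) ≡ 0
    ∑∑-zero = trans (∑∑-const 0) (trans (cong (m *_) (*-zeroʳ m)) (*-zeroʳ m))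

    ∑∑-mono-≤ : ∀ {f g : Fin m → Fin m → ℕ} → (∀ i j → f i j ≤ g i j) → ∑∑ f ≤ ∑∑ g
    ∑∑-mono-≤ f≤g = ∑-mono-≤ (λ i → ∑-mono-≤ (f≤g i))

    ∑∑-distrib-+ : ∀ (f g : Fin m → Fin m → ℕ) → ∑∑ (λ i j → f i j + g i j) ≡ ∑∑ f + ∑∑ g
    ∑∑-distrib-+ f g = trans (sum-cong-≗ {m} (λ i → ∑-distrib-+ (f i) (g i))) (∑-distrib-+ {m} _ _)

    ∑∑δ : ∑∑ {m} δ ≡ m
    ∑∑δ = trans (sum-cong-≗ {m} ∑δ) (trans (∑-const m 1) (*-identityʳ m))

    ∑∑δ*δ : ∀ (a b : Fin m) → ∑∑ (λ i j → δ a i * δ b j) ≡ 1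
    ∑∑δ*δ a b = begin
      ∑[ i < m ] (∑[ j < m ] (δ a i * δ b j))  ≡⟨ sum-cong-≗ {m} (λ i → *-distribˡ-sum (δ a i) (δ b)) ⟨
      ∑[ i < m ] (δ a i * ∑[ j < m ] δ b j)    ≡⟨ sum-cong-≗ {m} (λ i → cong (δ a i *_) (∑δ b)) ⟩
      ∑[ i < m ] (δ a i * 1)                   ≡⟨ sum-cong-≗ {m} (λ i → *-identityʳ (δ a i)) ⟩
      ∑[ i < m ] δ a i                         ≡⟨ ∑δ a ⟩
      1                                        ∎
      where open ≡-Reasoning

    module _ {A : Set} where

      ∑∑-length-++ : ∀ (F G : Fin m → Fin m → List A) →
                     ∑∑ (λ i j → length (F i j ++ G i j)) ≡ ∑∑ (λ i j → length (F i j)) + ∑∑ (λ i j → length (G i j))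
      ∑∑-length-++ F G = trans (∑∑-cong (λ i j → length-++ (F i j))) (∑∑-distrib-+ _ _)

      ∑∑-length-concatMap : ∀ {X : Set} (F : Fin m → Fin m → X → List A) {c} (xs : List X) →
                            (∀ {x} → x ∈ xs → ∑∑ (λ i j → length (F i j x)) ≡ c) →
                            ∑∑ (λ i j → length (concatMap (F i j) xs)) ≡ length xs * c
      ∑∑-length-concatMap F []       _    = ∑∑-zero
      ∑∑-length-concatMap F (x ∷ xs) each = trans (∑∑-length-++ (λ i j → F i j x) _)
        (cong₂ _+_ (each (here refl)) (∑∑-length-concatMap F xs (each ∘ there)))

  -- Differences modulo n

  negateMod : ℕ → ℕ → ℕ
  negateMod n zero    = zero
  negateMod n (suc v) = n ∸ suc v

  negateMod-involutive : ∀ {n v} → v < n → negateMod n (negateMod n v) ≡ v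
  negateMod-involutive {n} {zero}  _   = refl
  negateMod-involutive {n} {suc v} v<n with n ∸ suc v in eq
  ... | zero  = ⊥-elim (<⇒≢ (m<n⇒0<n∸m v<n) (sym eq))
  ... | suc _ = trans (cong (n ∸_) (sym eq)) (m∸[m∸n]≡n (<⇒≤ v<n))

  negateMod<n : ∀ {n v} → v < n → negateMod n v < n
  negateMod<n {suc n} {zero}  _ = s≤s z≤n
  negateMod<n {suc n} {suc v} _ = s≤s (m∸n≤m n v)

  module _ {n : ℕ} where

    diffMod-≤ : ∀ {x y : Fin n} → toℕ y ≤ toℕ x → diffMod x y ≡ toℕ x ∸ toℕ y
    diffMod-≤ {x} {y} y≤x with toℕ y ≤? toℕ x
    ... | yes _  = refl
    ... | no y≰x = ⊥-elim (y≰x y≤x)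

    diffMod-> : ∀ {x y : Fin n} → toℕ x < toℕ y → diffMod x y ≡ toℕ x + n ∸ toℕ y
    diffMod-> {x} {y} x<y with toℕ y ≤? toℕ x
    ... | yes y≤x = ⊥-elim (<⇒≱ x<y y≤x)
    ... | no _    = refl

    diffMod<n : ∀ (x y : Fin n) → diffMod x y < n
    diffMod<n x y with toℕ y ≤? toℕ x
    ... | yes _  = ≤-<-trans (m∸n≤m (toℕ x) (toℕ y)) (toℕ<n x)
    ... | no y≰x = begin-strict
      toℕ x + n ∸ toℕ y  <⟨ ∸-monoˡ-< (+-monoˡ-< n (≰⇒> y≰x)) (≤-trans (<⇒≤ (toℕ<n y)) (m≤n+m n (toℕ x))) ⟩
      toℕ y + n ∸ toℕ y  ≡⟨ m+n∸m≡n (toℕ y) n ⟩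
      n                  ∎
      where open ≤-Reasoning

    diffMod-self : ∀ (x : Fin n) → diffMod x x ≡ 0
    diffMod-self x = trans (diffMod-≤ {x} {x} ≤-refl) (n∸n≡0 (toℕ x))

    diffMod≡0⇒≡ : ∀ {x y : Fin n} → diffMod x y ≡ 0 → x ≡ y
    diffMod≡0⇒≡ {x} {y} d≡0 with toℕ y ≤? toℕ x
    ... | yes y≤x = toℕ-injective (≤-antisym (m∸n≡0⇒m≤n d≡0) y≤x)
    ... | no _    = ⊥-elim (<⇒≱ (toℕ<n y) (≤-trans (m≤n+m n (toℕ x)) (m∸n≡0⇒m≤n d≡0)))

    diffMod+diffMod-> : ∀ {x y : Fin n} → toℕ y < toℕ x → diffMod x y + diffMod y x ≡ n
    diffMod+diffMod-> {x} {y} y<x = begin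
      diffMod x y + diffMod y x          ≡⟨ cong₂ _+_ (diffMod-≤ (<⇒≤ y<x)) (diffMod-> y<x) ⟩
      (a ∸ b) + (b + n ∸ a)              ≡⟨ cong (λ t → (a ∸ b) + (b + n ∸ t)) (m+[n∸m]≡n (<⇒≤ y<x)) ⟨
      (a ∸ b) + (b + n ∸ (b + (a ∸ b)))  ≡⟨ cong ((a ∸ b) +_) ([m+n]∸[m+o]≡n∸o b n (a ∸ b)) ⟩
      (a ∸ b) + (n ∸ (a ∸ b))            ≡⟨ m+[n∸m]≡n (≤-trans (m∸n≤m a b) (<⇒≤ (toℕ<n x))) ⟩
      n                                  ∎
      where
      open ≡-Reasoning
      a b : ℕ
      a = toℕ x
      b = toℕ y

    diffMod+diffMod : ∀ {x y : Fin n} → x ≢ y → diffMod x y + diffMod y x ≡ n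
    diffMod+diffMod {x} {y} x≢y with <-cmp (toℕ x) (toℕ y)
    ... | tri< x<y _ _ = trans (+-comm (diffMod x y) _) (diffMod+diffMod-> x<y)
    ... | tri≈ _ x≡y _ = ⊥-elim (x≢y (toℕ-injective x≡y))
    ... | tri> _ _ y<x = diffMod+diffMod-> y<x

    diffMod-swap : ∀ (x y : Fin n) → diffMod y x ≡ negateMod n (diffMod x y)
    diffMod-swap x y with x Fin.≟ y
    ... | yes refl = trans (diffMod-self x) (cong (negateMod n) (sym (diffMod-self x)))
    ... | no x≢y with diffMod x y in dxy≡
    ...   | zero  = ⊥-elim (x≢y (diffMod≡0⇒≡ dxy≡))
    ...   | suc d = begin
      diffMod y x                                ≡⟨ m+n∸m≡n (diffMod x y) (diffMod y x) ⟨
      diffMod x y + diffMod y x ∸ diffMod x y    ≡⟨ cong₂ _∸_ (diffMod+diffMod x≢y) dxy≡ ⟩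
      n ∸ suc d                                  ∎
      where open ≡-Reasoning

    diffMod-fromℕ<-≤ : ∀ {a b} (a<n : a < n) (b<n : b < n) → b ≤ a → diffMod (fromℕ< a<n) (fromℕ< b<n) ≡ a ∸ b
    diffMod-fromℕ<-≤ a<n b<n b≤a = trans
      (diffMod-≤ (subst₂ _≤_ (sym (toℕ-fromℕ< b<n)) (sym (toℕ-fromℕ< a<n)) b≤a))
      (cong₂ _∸_ (toℕ-fromℕ< a<n) (toℕ-fromℕ< b<n))

    diffMod-fromℕ<-< : ∀ {a b} (a<n : a < n) (b<n : b < n) → a < b → diffMod (fromℕ< a<n) (fromℕ< b<n) ≡ n ∸ (b ∸ a)
    diffMod-fromℕ<-< {a} {b} a<n b<n a<b = begin
      diffMod x y                                ≡⟨ m+n∸n≡m (diffMod x y) (diffMod y x) ⟨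
      diffMod x y + diffMod y x ∸ diffMod y x    ≡⟨ cong₂ _∸_ (diffMod+diffMod x≢y)
                                                              (diffMod-fromℕ<-≤ b<n a<n (<⇒≤ a<b)) ⟩
      n ∸ (b ∸ a)                                ∎
      where
      open ≡-Reasoning
      x y : Fin n
      x = fromℕ< a<n
      y = fromℕ< b<n
      x≢y : x ≢ y
      x≢y x≡y = <⇒≢ a<b (trans (sym (toℕ-fromℕ< a<n)) (trans (cong toℕ x≡y) (toℕ-fromℕ< b<n)))

  module _ {m n : ℕ} where

    -- A copy of the function `pick` local to `blockDiffs`, which cannot be referred to by name.
    pairDiff : Fin m → Fin m → Point m n → Point m n → List ℕ
    pairDiff i j p q with p ≟ₚ q | proj₁ p Fin.≟ i | proj₁ q Fin.≟ j
    ... | no _ | yes _ | yes _ = diffMod (proj₂ p) (proj₂ q) ∷ []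
    ... | _    | _     | _     = []

    pairDiffs : Fin m → Fin m → List (Point m n) → List ℕ
    pairDiffs i j ps = concatMap (λ p → concatMap (pairDiff i j p) ps) ps

    -- If the two sides differed, they would differ at `pick p q` versus `pairDiff i j p q` for some
    -- points p, q; that hypothesis mentions `pick` applied to variables, so `with` can evaluate it.
    blockDiffs≡pairDiffs : ∀ {k} (i j : Fin m) (B : Block m n k) → blockDiffs i j B ≡ pairDiffs i j (pts B)
    blockDiffs≡pairDiffs i j B with List.≡-dec _≟_ (blockDiffs i j B) (pairDiffs i j (pts B))
    ... | yes eq = eq
    ... | no B≢ with concatMap-≢⇒∃ _≟_ _ _ (pts B) B≢
    ...   | p , _ , p≢ with concatMap-≢⇒∃ _≟_ _ _ (pts B) p≢
    ...     | q , _ , pq≢ with p ≟ₚ q | proj₁ p Fin.≟ i | proj₁ q Fin.≟ j | pq≢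
    ...       | yes _ | _     | _     | pick≢pairDiff = ⊥-elim (pick≢pairDiff refl)
    ...       | no _  | yes _ | yes _ | pick≢pairDiff = ⊥-elim (pick≢pairDiff refl)
    ...       | no _  | no _  | _     | pick≢pairDiff = ⊥-elim (pick≢pairDiff refl)
    ...       | no _  | yes _ | no _  | pick≢pairDiff = ⊥-elim (pick≢pairDiff refl)

    ∈-pairDiff⁺ : ∀ {i j : Fin m} {x y} → (i , x) ≢ (j , y) → diffMod x y ∈ pairDiff i j (i , x) (j , y)
    ∈-pairDiff⁺ {i} {j} {x} {y} p≢q with (i , x) ≟ₚ (j , y) | i Fin.≟ i | j Fin.≟ j
    ... | yes p≡q | _      | _      = ⊥-elim (p≢q p≡q)
    ... | no _    | yes _  | yes _  = here refl
    ... | no _    | no i≢i | _      = ⊥-elim (i≢i refl)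
    ... | no _    | yes _  | no j≢j = ⊥-elim (j≢j refl)

    ∈-pairDiff⁻ : ∀ {i j v} p q → v ∈ pairDiff i j p q →
                  p ≢ q × proj₁ p ≡ i × proj₁ q ≡ j × v ≡ diffMod (proj₂ p) (proj₂ q)
    ∈-pairDiff⁻ {i} {j} p q v∈ with p ≟ₚ q | proj₁ p Fin.≟ i | proj₁ q Fin.≟ j
    ∈-pairDiff⁻ p q (here v≡d) | no p≢q | yes p∈i | yes q∈j = p≢q , p∈i , q∈j , v≡d

    length-pairDiff : ∀ i j (p q : Point m n) →
                      length (pairDiff i j p q) ≡ (if does (p ≟ₚ q) then 0 else δ (proj₁ p) i * δ (proj₁ q) j)
    length-pairDiff i j p q with p ≟ₚ q | proj₁ p Fin.≟ i | proj₁ q Fin.≟ j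
    ... | yes _ | _     | _     = refl
    ... | no _  | yes _ | yes _ = refl
    ... | no _  | no _  | _     = refl
    ... | no _  | yes _ | no _  = refl

    ∑∑-length-pairDiff : ∀ (p q : Point m n) →
                         ∑∑ (λ i j → length (pairDiff i j p q)) ≡ (if does (p ≟ₚ q) then 0 else 1)
    ∑∑-length-pairDiff p q with p ≟ₚ q | ∑∑-cong (λ i j → length-pairDiff i j p q)
    ... | yes _ | eq = trans eq (∑∑-zero {m})
    ... | no _  | eq = trans eq (∑∑δ*δ (proj₁ p) (proj₁ q))

    ∑∑-length-pairDiffs-from : ∀ (p : Point m n) ps →
      ∑∑ (λ i j → length (concatMap (pairDiff i j p) ps)) ≡ length (filter (¬? ∘ (p ≟ₚ_)) ps)
    ∑∑-length-pairDiffs-from p []       = ∑∑-zero {m}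
    ∑∑-length-pairDiffs-from p (q ∷ ps) = trans (∑∑-length-++ (λ i j → pairDiff i j p q) _)
      (trans (cong₂ _+_ (∑∑-length-pairDiff p q) (∑∑-length-pairDiffs-from p ps)) filter-step)
      where
      filter-step : (if does (p ≟ₚ q) then 0 else 1) + length (filter (¬? ∘ (p ≟ₚ_)) ps) ≡
                    length (filter (¬? ∘ (p ≟ₚ_)) (q ∷ ps))
      filter-step with p ≟ₚ q
      ... | yes _ = refl
      ... | no _  = refl

    ∑∑-length-pairDiffs : ∀ {ps : List (Point m n)} → Unique ps →
                          ∑∑ (λ i j → length (pairDiffs i j ps)) ≡ length ps * (length ps ∸ 1)
    ∑∑-length-pairDiffs {ps} ps! = ∑∑-length-concatMap (λ i j p → concatMap (pairDiff i j p) ps) ps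
      (λ {p} p∈ps → trans (∑∑-length-pairDiffs-from p ps) (cong (_∸ 1) (length-filter-≢-∈ _≟ₚ_ ps! p∈ps)))

    module _ {k} (B : Block m n k) where

      ∈-blockDiffs⁺ : ∀ {i j x y} → (i , x) ∈ pts B → (j , y) ∈ pts B → (i , x) ≢ (j , y) →
                      diffMod x y ∈ blockDiffs i j B
      ∈-blockDiffs⁺ {i} {j} p∈B q∈B p≢q = subst (_ ∈_) (sym (blockDiffs≡pairDiffs i j B))
        (∈-concatMap⁺ _ (lose p∈B (∈-concatMap⁺ _ (lose q∈B (∈-pairDiff⁺ p≢q)))))

      ∈-blockDiffs⁻ : ∀ {i j v} → v ∈ blockDiffs i j B →
                      ∃[ x ] ∃[ y ] (i , x) ∈ pts B × (j , y) ∈ pts B × (i , x) ≢ (j , y) × v ≡ diffMod x y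
      ∈-blockDiffs⁻ {i} {j} v∈B with find (∈-concatMap⁻ _ (subst (_ ∈_) (blockDiffs≡pairDiffs i j B) v∈B))
      ... | p , p∈B , v∈p with find (∈-concatMap⁻ _ {xs = pts B} v∈p)
      ...   | q , q∈B , v∈pq with ∈-pairDiff⁻ {i} {j} p q v∈pq
      ...     | p≢q , refl , refl , v≡d = proj₂ p , proj₂ q , p∈B , q∈B , p≢q , v≡d

      ∑∑-length-blockDiffs : ∑∑ (λ i j → length (blockDiffs i j B)) ≡ k * (k ∸ 1)
      ∑∑-length-blockDiffs = trans (∑∑-cong (λ i j → cong length (blockDiffs≡pairDiffs i j B)))
        (subst (λ l → ∑∑ (λ i j → length (pairDiffs i j (pts B))) ≡ l * (l ∸ 1)) (size B)
          (∑∑-length-pairDiffs (unique B)))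

  -- Differences of a code, and the upper bound

  module _ {m n k : ℕ} where

    distinct-points : (B : Block m n k) → 2 ≤ k → ∃[ p ] ∃[ q ] p ∈ pts B × q ∈ pts B × p ≢ q
    distinct-points (block (p ∷ q ∷ _) ((p≢q ∷ _) ∷ _) _) _ = p , q , here refl , there (here refl) , p≢q
    distinct-points (block []       _ refl) ()
    distinct-points (block (_ ∷ []) _ refl) (s≤s ())

    ∑∑-length-Δ : (C : List (Block m n k)) → ∑∑ (λ i j → length (Δ i j C)) ≡ length C * (k * (k ∸ 1))
    ∑∑-length-Δ C = ∑∑-length-concatMap blockDiffs C (λ {B} _ → ∑∑-length-blockDiffs B)

    ∈-Δ⁺ : ∀ {i j v} {C : List (Block m n k)} {B} → B ∈ C → v ∈ blockDiffs i j B → v ∈ Δ i j C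
    ∈-Δ⁺ B∈C v∈B = ∈-concatMap⁺ _ (lose B∈C v∈B)

    ∈-Δ⁻ : ∀ {i j v} {C : List (Block m n k)} → v ∈ Δ i j C → ∃[ B ] B ∈ C × v ∈ blockDiffs i j B
    ∈-Δ⁻ {C = C} v∈Δ = find (∈-concatMap⁻ _ {xs = C} v∈Δ)

    diffMod∈Δ : ∀ {i j x y} {C : List (Block m n k)} {B} → B ∈ C → (i , x) ∈ pts B → (j , y) ∈ pts B →
                (i , x) ≢ (j , y) → diffMod x y ∈ Δ i j C
    diffMod∈Δ {B = B} B∈C p∈B q∈B p≢q = ∈-Δ⁺ B∈C (∈-blockDiffs⁺ B p∈B q∈B p≢q)

    Δ-swap : ∀ {i j v} {C : List (Block m n k)} → v ∈ Δ i j C → negateMod n v ∈ Δ j i C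
    Δ-swap {i} {j} {C = C} v∈Δ with ∈-Δ⁻ {i} {j} {C = C} v∈Δ
    ... | B , B∈C , v∈B with ∈-blockDiffs⁻ B v∈B
    ...   | x , y , p∈B , q∈B , p≢q , refl = ∈-Δ⁺ {j} {i} {C = C} B∈C
      (subst (_∈ blockDiffs j i B) (diffMod-swap x y) (∈-blockDiffs⁺ B q∈B p∈B (p≢q ∘ sym)))

    Δ-swap⁻ : ∀ {i j v} {C : List (Block m n k)} → v < n → negateMod n v ∈ Δ i j C → v ∈ Δ j i C
    Δ-swap⁻ {i} {j} {C = C} v<n v∈Δ = subst (_∈ Δ j i C) (negateMod-involutive v<n) (Δ-swap {i} {j} {C = C} v∈Δ)

    Δ-<n : ∀ {i j v} {C : List (Block m n k)} → v ∈ Δ i j C → v < n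
    Δ-<n {i} {j} {C = C} v∈Δ with ∈-Δ⁻ {i} {j} {C = C} v∈Δ
    ... | B , _ , v∈B with ∈-blockDiffs⁻ B v∈B
    ...   | x , y , _ , _ , _ , refl = diffMod<n x y

    0∉Δ-diagonal : ∀ {i} {C : List (Block m n k)} → 0 ∉ Δ i i C
    0∉Δ-diagonal {i} {C} 0∈Δ with ∈-Δ⁻ {i} {i} {C = C} 0∈Δ
    ... | B , _ , 0∈B with ∈-blockDiffs⁻ B 0∈B
    ...   | x , y , _ , _ , p≢q , 0≡d = p≢q (cong (i ,_) (diffMod≡0⇒≡ (sym 0≡d)))

    Unique-Δ⇒distinct : 2 ≤ k → (C : List (Block m n k)) → (∀ i j → Unique (Δ i j C)) →
                        AllPairs (λ B B′ → ¬ (pts B ↭ pts B′)) C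
    Unique-Δ⇒distinct 2≤k []      _  = []
    Unique-Δ⇒distinct 2≤k (B ∷ C) Δ! =
      All.tabulate (λ B′∈C B↭B′ → repeated B′∈C B↭B′ (distinct-points B 2≤k)) ∷
      Unique-Δ⇒distinct 2≤k C (λ i j → Unique-++⁻ʳ (blockDiffs i j B) (Δ! i j))
      where
      repeated : ∀ {B′} → B′ ∈ C → pts B ↭ pts B′ → ¬ (∃[ p ] ∃[ q ] p ∈ pts B × q ∈ pts B × p ≢ q)
      repeated {B′} B′∈C B↭B′ ((i , x) , (j , y) , p∈B , q∈B , p≢q) =
        Unique-++⇒∉ (blockDiffs i j B) (Δ! i j) (∈-blockDiffs⁺ B p∈B q∈B p≢q)
          (∈-Δ⁺ {C = C} B′∈C (∈-blockDiffs⁺ B′ (∈-resp-↭ B↭B′ p∈B) (∈-resp-↭ B↭B′ q∈B) p≢q))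

    length-Δ+δ≤n : 0 < n → ∀ {C : List (Block m n k)} → IsOOC m n k C → ∀ i j → length (Δ i j C) + δ i j ≤ n
    length-Δ+δ≤n 0<n {C} ooc i j with i Fin.≟ j
    ... | yes refl = subst₂ _≤_ (+-comm 1 _) (length-downFrom n)
      (Unique-⊆⇒length≤ _≟_ (¬Any⇒All¬ (Δ i i C) (0∉Δ-diagonal {i} {C}) ∷ IsOOC.diffs ooc i i) 0∷Δ⊆)
      where
      0∷Δ⊆ : 0 ∷ Δ i i C ⊆ downFrom n
      0∷Δ⊆ (here refl)  = ∈-downFrom⁺ 0<n
      0∷Δ⊆ (there v∈Δ) = ∈-downFrom⁺ (Δ-<n {C = C} v∈Δ)
    ... | no _ = subst₂ _≤_ (sym (+-identityʳ _)) (length-downFrom n)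
      (Unique-⊆⇒length≤ _≟_ (IsOOC.diffs ooc i j) (∈-downFrom⁺ ∘ Δ-<n {C = C}))

    ooc-size-bound : 0 < n → ∀ {C : List (Block m n k)} → IsOOC m n k C →
                     length C * (k * (k ∸ 1)) + m ≤ m * (m * n)
    ooc-size-bound 0<n {C} ooc = begin
      length C * (k * (k ∸ 1)) + m             ≡⟨ cong₂ _+_ (∑∑-length-Δ C) (∑∑δ {m}) ⟨
      ∑∑ (λ i j → length (Δ i j C)) + ∑∑ {m} δ  ≡⟨ ∑∑-distrib-+ {m} (λ i j → length (Δ i j C)) δ ⟨
      ∑∑ (λ i j → length (Δ i j C) + δ i j)     ≤⟨ ∑∑-mono-≤ {m} (length-Δ+δ≤n 0<n ooc) ⟩
      ∑∑ {m} (λ _ _ → n)                        ≡⟨ ∑∑-const {m} n ⟩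
      m * (m * n)                               ∎
      where open ≤-Reasoning

  covers-tight⇒Unique : ∀ {m n} (L : Fin m → Fin m → List ℕ) → (∀ i j → downFrom n ⊆ L i j) →
                        ∑∑ (λ i j → length (L i j)) ≤ m * (m * n) → ∀ i j → Unique (L i j)
  covers-tight⇒Unique {m} {n} L covers total≤ i j =
    ⊆-length≤⇒Unique _≟_ (downFrom⁺ n) (covers i j) (subst (_ ≤_) (sym (length-downFrom n)) entry≤n)
    where
    n≤entry : ∀ i j → n ≤ length (L i j)
    n≤entry i j = subst (_≤ _) (length-downFrom n) (Unique-⊆⇒length≤ _≟_ (downFrom⁺ n) (covers i j))
    row≤ : ∀ i → ∑[ j < m ] length (L i j) ≤ ∑[ j < m ] n
    row≤ = ∑-tight (λ i → ∑[ j < m ] length (L i j)) (λ _ → ∑[ j < m ] n) (λ i → ∑-mono-≤ (n≤entry i))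
      (subst (_ ≤_) (sym (∑∑-const {m} n)) total≤)
    entry≤n : length (L i j) ≤ n
    entry≤n = ∑-tight (λ j → length (L i j)) (λ _ → n) (n≤entry i) (row≤ i) j

Covered : (ℕ → Set) → ℕ → ℕ → Set
Covered P a b = ∀ v → a ≤ v → v < b → P v

module _ {P : ℕ → Set} where

  Covered-empty : ∀ {a b} → b ≤ a → Covered P a b
  Covered-empty b≤a v a≤v v<b = ⊥-elim (<⇒≱ v<b (≤-trans b≤a a≤v))

  Covered-point : ∀ {a} → P a → Covered P a (suc a)
  Covered-point Pa v a≤v v<1+a = subst P (≤-antisym a≤v (≤-pred v<1+a)) Pa

  Covered-cast : ∀ {a a′ b b′} → Covered P a b → a ≡ a′ → b ≡ b′ → Covered P a′ b′
  Covered-cast ab refl refl = ab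

  infixl 4 _⟫_⟨_⟩
  _⟫_⟨_⟩ : ∀ {a b b′ c} → Covered P a b → Covered P b′ c → b ≡ b′ → Covered P a c
  _⟫_⟨_⟩ {b = b} ab bc refl v a≤v v<c with v <? b
  ... | yes v<b = ab v a≤v v<b
  ... | no  v≮b = bc v (≮⇒≥ v≮b) v<c

Covered-map : ∀ {P Q : ℕ → Set} {a b} → (∀ {v} → P v → Q v) → Covered P a b → Covered Q a b
Covered-map P⇒Q ab v a≤v v<b = P⇒Q (ab v a≤v v<b)

Covered⇒downFrom⊆ : ∀ {n} {L : List ℕ} → Covered (_∈ L) 0 n → downFrom n ⊆ L
Covered⇒downFrom⊆ cover v∈ = cover _ z≤n (∈-downFrom⁻ v∈)

even⊎odd : ∀ d → ∃[ t ] (d ≡ t + t ⊎ d ≡ 1 + (t + t))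
even⊎odd zero    = 0 , inj₁ refl
even⊎odd (suc d) with even⊎odd d
... | t , inj₁ d≡2t   = t , inj₂ (cong suc d≡2t)
... | t , inj₂ d≡2t+1 = suc t , inj₁ (trans (cong suc d≡2t+1) (cong suc (sym (+-suc t t))))

double-<⇒< : ∀ {s t} → s + s < t + t → s < t
double-<⇒< {s} {t} 2s<2t with s <? t
... | yes s<t = s<t
... | no  s≮t = ⊥-elim (<⇒≱ 2s<2t (+-mono-≤ (≮⇒≥ s≮t) (≮⇒≥ s≮t)))

Covered-by-parity : ∀ {P : ℕ → Set} {E O h} → Covered (λ t → P (t + t)) 1 E → Covered (λ t → P (1 + (t + t))) 0 O →
                    h ≤ E + E → h ≤ 1 + (O + O) → Covered P 1 h
Covered-by-parity evens odds h≤2E h≤2O+1 d 1≤d d<h with even⊎odd d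
... | zero  , inj₁ refl = ⊥-elim (<⇒≱ 1≤d z≤n)
... | suc t , inj₁ refl = evens (suc t) (s≤s z≤n) (double-<⇒< (<-≤-trans d<h h≤2E))
... | t     , inj₂ refl = odds t z≤n (double-<⇒< (≤-pred (<-≤-trans d<h h≤2O+1)))

-- Chords and pairings of ℤ_n

record Chord (n : ℕ) : Set where
  constructor chord
  field
    lo hi : ℕ
    lo<hi : lo < hi
    hi<n  : hi < n

  span : ℕ
  span = hi ∸ lo
open Chord public

Touches : ∀ {n} → ℕ → Chord n → Set
Touches v c = lo c ≡ v ⊎ hi c ≡ v

Spans : ∀ {n} → ℕ → Chord n → Set
Spans {n} d c = span c ≡ d ⊎ n ∸ span c ≡ d

record Pairing (n h g : ℕ) : Set where
  field
    chords      : List (Chord n)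
    count       : suc (length chords) ≡ h
    cells-below : Covered (λ v → Any (Touches v) chords) 1 g
    cells-above : Covered (λ v → Any (Touches v) chords) (suc g) n
    spans       : Covered (λ d → Any (Spans d) chords) 1 h

module _ {n : ℕ} where

  -- The chords {L + i, L + 2·len + gap − 1 − i} for i < len, nested around `gap` free points.
  nest : ∀ L len gap → len + (gap + (len + L)) ≤ n → List (Chord n)
  nest L zero      gap _    = []
  nest L (suc len) gap fits =
    chord L (len + (gap + (suc len + L))) (≤-trans (s≤s (m≤n+m L len)) (≤-trans (m≤n+m _ gap) (m≤n+m _ len))) fits
    ∷ nest (suc L) len gap (≤-trans (≤-reflexive (cong (λ t → len + (gap + t)) (+-suc len L))) (<⇒≤ fits))

  length-nest : ∀ L len gap fits → length (nest L len gap fits) ≡ len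
  length-nest L zero      gap _    = refl
  length-nest L (suc len) gap fits = cong suc (length-nest (suc L) len gap _)

  nest-lo : ∀ L len gap fits → Covered (λ v → Any (λ c → lo c ≡ v) (nest L len gap fits)) L (len + L)
  nest-lo L zero      gap _    = Covered-empty ≤-refl
  nest-lo L (suc len) gap fits = Covered-cast
    (Covered-point (here refl) ⟫ Covered-map there (nest-lo (suc L) len gap _) ⟨ refl ⟩)
    refl (+-suc len L)

  nest-hi : ∀ L len gap fits →
            Covered (λ v → Any (λ c → hi c ≡ v) (nest L len gap fits)) (gap + (len + L)) (len + (gap + (len + L)))
  nest-hi L zero      gap _    = Covered-empty ≤-refl
  nest-hi L (suc len) gap fits = Covered-cast
    (Covered-map there (nest-hi (suc L) len gap _) ⟫ Covered-point (here refl) ⟨ cong (λ t → len + (gap + t)) (+-suc len L) ⟩)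
    (cong (gap +_) (+-suc len L)) refl

  outer-span : ∀ L len gap → len + (gap + (suc len + L)) ∸ L ≡ gap + 1 + (len + len)
  outer-span L len gap = begin
    len + (gap + (suc len + L)) ∸ L  ≡⟨ cong (_∸ L) (solve (L ∷ len ∷ gap ∷ [])) ⟩
    gap + 1 + (len + len) + L ∸ L    ≡⟨ m+n∸n≡m (gap + 1 + (len + len)) L ⟩
    gap + 1 + (len + len)            ∎
    where open ≡-Reasoning

  nest-spans : ∀ L len gap fits {e q} → gap + 1 ≡ e + (q + q) →
               Covered (λ t → Any (λ c → span c ≡ e + (t + t)) (nest L len gap fits)) q (len + q)
  nest-spans L zero      gap _    _  = Covered-empty ≤-refl
  nest-spans L (suc len) gap fits {e} {q} eq =
    Covered-map there (nest-spans (suc L) len gap _ {e} {q} eq) ⟫ Covered-point (here outer≡) ⟨ refl ⟩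
    where
    outer≡ : len + (gap + (suc len + L)) ∸ L ≡ e + ((len + q) + (len + q))
    outer≡ = begin
      len + (gap + (suc len + L)) ∸ L  ≡⟨ outer-span L len gap ⟩
      gap + 1 + (len + len)            ≡⟨ cong (_+ (len + len)) eq ⟩
      e + (q + q) + (len + len)        ≡⟨ solve (e ∷ q ∷ len ∷ []) ⟩
      e + ((len + q) + (len + q))      ∎
      where open ≡-Reasoning

  -- Measured the other way round ℤ_n, the outermost chord is the shortest one.
  nest-cospans : ∀ L len gap fits {R e q} → n ≡ R + (len + (gap + (len + L))) → L + R + 1 ≡ e + (q + q) →
                 Covered (λ t → Any (λ c → n ∸ span c ≡ e + (t + t)) (nest L len gap fits)) q (len + q)
  nest-cospans L zero      gap _    _  _  = Covered-empty ≤-refl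
  nest-cospans L (suc len) gap fits {R} {e} {q} n≡ eq = Covered-cast
    (Covered-point (here outer≡) ⟫ Covered-map there (nest-cospans (suc L) len gap _ {suc R} {e} {suc q} n≡′ eq′) ⟨ refl ⟩)
    refl (+-suc len q)
    where
    n≡′ : n ≡ suc R + (len + (gap + (len + suc L)))
    n≡′ = trans n≡ (solve (R ∷ len ∷ gap ∷ L ∷ []))
    eq′ : suc L + suc R + 1 ≡ e + (suc q + suc q)
    eq′ = begin
      suc L + suc R + 1        ≡⟨ solve (L ∷ R ∷ []) ⟩
      suc (suc (L + R + 1))    ≡⟨ cong (suc ∘ suc) eq ⟩
      suc (suc (e + (q + q)))  ≡⟨ solve (e ∷ q ∷ []) ⟩
      e + (suc q + suc q)      ∎
      where open ≡-Reasoning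
    outer≡ : n ∸ (len + (gap + (suc len + L)) ∸ L) ≡ e + (q + q)
    outer≡ = begin
      n ∸ (len + (gap + (suc len + L)) ∸ L)                             ≡⟨ cong₂ _∸_ n≡ (outer-span L len gap) ⟩
      R + (suc len + (gap + (suc len + L))) ∸ (gap + 1 + (len + len))   ≡⟨ cong (_∸ (gap + 1 + (len + len)))
                                                                             (solve (R ∷ len ∷ gap ∷ L ∷ [])) ⟩
      (gap + 1 + (len + len)) + (L + R + 1) ∸ (gap + 1 + (len + len))   ≡⟨ m+n∸m≡n (gap + 1 + (len + len)) _ ⟩
      L + R + 1                                                         ≡⟨ eq ⟩
      e + (q + q)                                                       ∎
      where open ≡-Reasoning

module _ {n : ℕ} {Ns : List (List (Chord n))} {N : List (Chord n)} (N∈Ns : N ∈ Ns) where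

  Any-concat : ∀ {P : Chord n → Set} → Any P N → Any P (concat Ns)
  Any-concat {P} PN = concat⁺ (Any.map (λ N≡N′ → subst (Any P) N≡N′ PN) N∈Ns)

  lo-cells : ∀ {a b} → Covered (λ v → Any (λ c → lo c ≡ v) N) a b → Covered (λ v → Any (Touches v) (concat Ns)) a b
  lo-cells = Covered-map (Any-concat ∘ Any.map inj₁)

  hi-cells : ∀ {a b} → Covered (λ v → Any (λ c → hi c ≡ v) N) a b → Covered (λ v → Any (Touches v) (concat Ns)) a b
  hi-cells = Covered-map (Any-concat ∘ Any.map inj₂)

  direct-spans : ∀ {a b} {f : ℕ → ℕ} → Covered (λ t → Any (λ c → span c ≡ f t) N) a b →
                 Covered (λ t → Any (Spans (f t)) (concat Ns)) a b
  direct-spans = Covered-map (Any-concat ∘ Any.map inj₁)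

  wrapped-spans : ∀ {a b} {f : ℕ → ℕ} → Covered (λ t → Any (λ c → n ∸ span c ≡ f t) N) a b →
                  Covered (λ t → Any (Spans (f t)) (concat Ns)) a b
  wrapped-spans = Covered-map (Any-concat ∘ Any.map inj₂)

length-concat : ∀ {A : Set} (xss : List (List A)) → length (concat xss) ≡ foldr (λ xs l → length xs + l) 0 xss
length-concat []         = refl
length-concat (xs ∷ xss) = trans (length-++ xs) (cong (length xs +_) (length-concat xss))

≤-from-slack : ∀ {x n} y → n ≡ x + y → x ≤ n
≤-from-slack {x} y n≡x+y = subst (x ≤_) (sym n≡x+y) (m≤m+n x y)

-- Chords {1 + i, 2b + 1 − i} (i < b) and {2b + 2 + i, 2b + 2a + 1 − i} (i < a), hole b + 1.
skolem-pairing : ∀ {n} a b → b ≤ a → a ≤ suc b → n ≡ a + (a + (b + (1 + (b + 1)))) → Pairing n (suc (b + a)) (b + 1)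
skolem-pairing {n} a b b≤a a≤1+b n≡ = record
  { chords      = concat Ns
  ; count       = cong suc length≡
  ; cells-below = lo-cells inE (nest-lo 1 b 1 E-fits)
  ; cells-above = Covered-cast
      (hi-cells inE (nest-hi 1 b 1 E-fits)
        ⟫ lo-cells inO (nest-lo L a 0 O-fits) ⟨ refl ⟩
        ⟫ hi-cells inO (nest-hi L a 0 O-fits) ⟨ refl ⟩)
      refl (sym n≡)
  ; spans       = Covered-by-parity
      (direct-spans inE (nest-spans 1 b 1 E-fits {0} {1} refl))
      (direct-spans inO (nest-spans L a 0 O-fits {1} {0} refl))
      h≤2E h≤2O+1
  }
  where
  L : ℕ
  L = b + (1 + (b + 1))
  O-fits : a + (0 + (a + L)) ≤ n
  O-fits = ≤-reflexive (sym n≡)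
  E-fits : b + (1 + (b + 1)) ≤ n
  E-fits = ≤-trans (m≤n+m L a) (≤-trans (m≤n+m (a + L) a) O-fits)
  E O : List (Chord n)
  E = nest 1 b 1 E-fits
  O = nest L a 0 O-fits
  Ns : List (List (Chord n))
  Ns = E ∷ O ∷ []
  inE : E ∈ Ns
  inE = here refl
  inO : O ∈ Ns
  inO = there (here refl)
  h≤2E : suc (b + a) ≤ (b + 1) + (b + 1)
  h≤2E = begin
    suc (b + a)        ≤⟨ s≤s (+-monoʳ-≤ b a≤1+b) ⟩
    suc (b + suc b)    ≡⟨ solve (b ∷ []) ⟩
    (b + 1) + (b + 1)  ∎
    where open ≤-Reasoning
  h≤2O+1 : suc (b + a) ≤ 1 + ((a + 0) + (a + 0))
  h≤2O+1 = begin
    suc (b + a)              ≤⟨ s≤s (+-monoˡ-≤ a b≤a) ⟩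
    suc (a + a)              ≡⟨ solve (a ∷ []) ⟩
    1 + ((a + 0) + (a + 0))  ∎
    where open ≤-Reasoning
  length≡ : length (E ++ O ++ []) ≡ b + a
  length≡ = begin
    length (E ++ O ++ [])        ≡⟨ length-++ E ⟩
    length E + length (O ++ [])  ≡⟨ cong₂ _+_ (length-nest 1 b 1 E-fits) (cong length (++-identityʳ O)) ⟩
    b + length O                 ≡⟨ cong (b +_) (length-nest L a 0 O-fits) ⟩
    b + a                        ∎
    where open ≡-Reasoning

-- Chords {1, 2r + 3}, {2 + i, 8r + 7 − i} (i ≤ 2r), {2r + 4 + i, 6r + 6 − i}, {3r + 4 + i, 5r + 4 − i}
-- (i < r) and {5r + 5, 5r + 6}, hole 4r + 4.
pairing-8r+8 : ∀ {n} r → n ≡ 8 * r + 8 → Pairing n (4 * r + 4) (4 * r + 4)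
pairing-8r+8 {n} r n≡ = record
  { chords      = concat Ns
  ; count       = count≡
  ; cells-below = Covered-cast
      (lo-cells inS₂ (nest-lo 1 1 (2 * r + 1) _)
        ⟫ lo-cells inW (nest-lo 2 (2 * r + 1) (4 * r + 4) _) ⟨ refl ⟩
        ⟫ hi-cells inS₂ (nest-hi 1 1 (2 * r + 1) _) ⟨ refl ⟩
        ⟫ lo-cells inE₂ (nest-lo (2 * r + 4) r (2 * r + 3) _) ⟨ solve (r ∷ []) ⟩
        ⟫ lo-cells inE₁ (nest-lo (3 * r + 4) r 1 _) ⟨ solve (r ∷ []) ⟩)
      refl below-end
  ; cells-above = Covered-cast
      (hi-cells inE₁ (nest-hi (3 * r + 4) r 1 _)
        ⟫ lo-cells inS₁ (nest-lo (5 * r + 5) 1 0 _) ⟨ solve (r ∷ []) ⟩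
        ⟫ hi-cells inS₁ (nest-hi (5 * r + 5) 1 0 _) ⟨ refl ⟩
        ⟫ hi-cells inE₂ (nest-hi (2 * r + 4) r (2 * r + 3) _) ⟨ solve (r ∷ []) ⟩
        ⟫ hi-cells inW (nest-hi 2 (2 * r + 1) (4 * r + 4) _) ⟨ solve (r ∷ []) ⟩)
      above-start above-end
  ; spans       = Covered-by-parity
      (direct-spans inE₁ (nest-spans (3 * r + 4) r 1 _ {0} {1} refl)
        ⟫ direct-spans inS₂ (nest-spans 1 1 (2 * r + 1) _ {0} {r + 1} (solve (r ∷ []))) ⟨ refl ⟩
        ⟫ direct-spans inE₂ (nest-spans (2 * r + 4) r (2 * r + 3) _ {0} {r + 2} (solve (r ∷ []))) ⟨ solve (r ∷ []) ⟩)
      (direct-spans inS₁ (nest-spans (5 * r + 5) 1 0 _ {1} {0} refl)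
        ⟫ wrapped-spans inW (nest-cospans 2 (2 * r + 1) (4 * r + 4) _ {0} {1} {1} (trans n≡ (solve (r ∷ []))) refl) ⟨ refl ⟩)
      h≤2E h≤2O+1
  }
  where
  S₂ W E₂ E₁ S₁ : List (Chord n)
  S₂ = nest 1 1 (2 * r + 1) (≤-from-slack (6 * r + 4) (trans n≡ (solve (r ∷ []))))
  W  = nest 2 (2 * r + 1) (4 * r + 4) (≤-from-slack 0 (trans n≡ (solve (r ∷ []))))
  E₂ = nest (2 * r + 4) r (2 * r + 3) (≤-from-slack (2 * r + 1) (trans n≡ (solve (r ∷ []))))
  E₁ = nest (3 * r + 4) r 1 (≤-from-slack (3 * r + 3) (trans n≡ (solve (r ∷ []))))
  S₁ = nest (5 * r + 5) 1 0 (≤-from-slack (3 * r + 1) (trans n≡ (solve (r ∷ []))))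
  Ns : List (List (Chord n))
  Ns = S₂ ∷ W ∷ E₂ ∷ E₁ ∷ S₁ ∷ []
  inS₂ : S₂ ∈ Ns
  inS₂ = here refl
  inW : W ∈ Ns
  inW = there (here refl)
  inE₂ : E₂ ∈ Ns
  inE₂ = there (there (here refl))
  inE₁ : E₁ ∈ Ns
  inE₁ = there (there (there (here refl)))
  inS₁ : S₁ ∈ Ns
  inS₁ = there (there (there (there (here refl))))
  below-end : r + (3 * r + 4) ≡ 4 * r + 4
  below-end = solve (r ∷ [])
  above-start : 1 + (r + (3 * r + 4)) ≡ suc (4 * r + 4)
  above-start = solve (r ∷ [])
  above-end : 2 * r + 1 + (4 * r + 4 + (2 * r + 1 + 2)) ≡ n
  above-end = sym (trans n≡ (solve (r ∷ [])))
  h≤2E : 4 * r + 4 ≤ (r + (r + 2)) + (r + (r + 2))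
  h≤2E = ≤-reflexive (solve (r ∷ []))
  h≤2O+1 : 4 * r + 4 ≤ 1 + ((2 * r + 1 + 1) + (2 * r + 1 + 1))
  h≤2O+1 = ≤-from-slack 1 (solve (r ∷ []))
  count≡ : suc (length (concat Ns)) ≡ 4 * r + 4
  count≡ = begin
    suc (length (concat Ns))
      ≡⟨ cong suc (length-concat Ns) ⟩
    suc (1 + (length W + (length E₂ + (length E₁ + (1 + 0)))))
      ≡⟨ cong₂ (λ w e → suc (1 + (w + e))) (length-nest 2 (2 * r + 1) (4 * r + 4) _)
           (cong₂ (λ e₂ e₁ → e₂ + (e₁ + (1 + 0))) (length-nest (2 * r + 4) r (2 * r + 3) _) (length-nest (3 * r + 4) r 1 _)) ⟩
    suc (1 + ((2 * r + 1) + (r + (r + (1 + 0)))))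
      ≡⟨ solve (r ∷ []) ⟩
    4 * r + 4
      ∎
    where open ≡-Reasoning

-- Chords {1, 6r + 5}, {2 + i, 8r + 5 − i} (i < 2r), {2r + 2 + i, 6r + 4 − i}, {3r + 2 + i, 5r + 2 − i}
-- (i < r) and {5r + 3, 5r + 4}, hole 4r + 2.
pairing-8r+6 : ∀ {n} r → n ≡ 8 * r + 6 → Pairing n (4 * r + 3) (4 * r + 2)
pairing-8r+6 {n} r n≡ = record
  { chords      = concat Ns
  ; count       = count≡
  ; cells-below = Covered-cast
      (lo-cells inS₂ (nest-lo 1 1 (6 * r + 3) _)
        ⟫ lo-cells inW (nest-lo 2 (2 * r) (4 * r + 4) _) ⟨ refl ⟩
        ⟫ lo-cells inE₂ (nest-lo (2 * r + 2) r (2 * r + 3) _) ⟨ refl ⟩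
        ⟫ lo-cells inE₁ (nest-lo (3 * r + 2) r 1 _) ⟨ solve (r ∷ []) ⟩)
      refl below-end
  ; cells-above = Covered-cast
      (hi-cells inE₁ (nest-hi (3 * r + 2) r 1 _)
        ⟫ lo-cells inS₁ (nest-lo (5 * r + 3) 1 0 _) ⟨ solve (r ∷ []) ⟩
        ⟫ hi-cells inS₁ (nest-hi (5 * r + 3) 1 0 _) ⟨ refl ⟩
        ⟫ hi-cells inE₂ (nest-hi (2 * r + 2) r (2 * r + 3) _) ⟨ solve (r ∷ []) ⟩
        ⟫ hi-cells inS₂ (nest-hi 1 1 (6 * r + 3) _) ⟨ solve (r ∷ []) ⟩
        ⟫ hi-cells inW (nest-hi 2 (2 * r) (4 * r + 4) _) ⟨ solve (r ∷ []) ⟩)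
      above-start above-end
  ; spans       = Covered-by-parity
      (direct-spans inE₁ (nest-spans (3 * r + 2) r 1 _ {0} {1} refl)
        ⟫ wrapped-spans inS₂
            (nest-cospans 1 1 (6 * r + 3) _ {2 * r} {0} {r + 1} (trans n≡ (solve (r ∷ []))) (solve (r ∷ []))) ⟨ refl ⟩
        ⟫ direct-spans inE₂ (nest-spans (2 * r + 2) r (2 * r + 3) _ {0} {r + 2} (solve (r ∷ []))) ⟨ solve (r ∷ []) ⟩)
      (direct-spans inS₁ (nest-spans (5 * r + 3) 1 0 _ {1} {0} refl)
        ⟫ wrapped-spans inW (nest-cospans 2 (2 * r) (4 * r + 4) _ {0} {1} {1} (trans n≡ (solve (r ∷ []))) refl) ⟨ refl ⟩)
      h≤2E h≤2O+1
  }
  where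
  S₂ W E₂ E₁ S₁ : List (Chord n)
  S₂ = nest 1 1 (6 * r + 3) (≤-from-slack (2 * r) (trans n≡ (solve (r ∷ []))))
  W  = nest 2 (2 * r) (4 * r + 4) (≤-from-slack 0 (trans n≡ (solve (r ∷ []))))
  E₂ = nest (2 * r + 2) r (2 * r + 3) (≤-from-slack (2 * r + 1) (trans n≡ (solve (r ∷ []))))
  E₁ = nest (3 * r + 2) r 1 (≤-from-slack (3 * r + 3) (trans n≡ (solve (r ∷ []))))
  S₁ = nest (5 * r + 3) 1 0 (≤-from-slack (3 * r + 1) (trans n≡ (solve (r ∷ []))))
  Ns : List (List (Chord n))
  Ns = S₂ ∷ W ∷ E₂ ∷ E₁ ∷ S₁ ∷ []
  inS₂ : S₂ ∈ Ns
  inS₂ = here refl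
  inW : W ∈ Ns
  inW = there (here refl)
  inE₂ : E₂ ∈ Ns
  inE₂ = there (there (here refl))
  inE₁ : E₁ ∈ Ns
  inE₁ = there (there (there (here refl)))
  inS₁ : S₁ ∈ Ns
  inS₁ = there (there (there (there (here refl))))
  below-end : r + (3 * r + 2) ≡ 4 * r + 2
  below-end = solve (r ∷ [])
  above-start : 1 + (r + (3 * r + 2)) ≡ suc (4 * r + 2)
  above-start = solve (r ∷ [])
  above-end : 2 * r + (4 * r + 4 + (2 * r + 2)) ≡ n
  above-end = sym (trans n≡ (solve (r ∷ [])))
  h≤2E : 4 * r + 3 ≤ (r + (r + 2)) + (r + (r + 2))
  h≤2E = ≤-from-slack 1 (solve (r ∷ []))
  h≤2O+1 : 4 * r + 3 ≤ 1 + ((2 * r + 1) + (2 * r + 1))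
  h≤2O+1 = ≤-reflexive (solve (r ∷ []))
  count≡ : suc (length (concat Ns)) ≡ 4 * r + 3
  count≡ = begin
    suc (length (concat Ns))
      ≡⟨ cong suc (length-concat Ns) ⟩
    suc (1 + (length W + (length E₂ + (length E₁ + (1 + 0)))))
      ≡⟨ cong₂ (λ w e → suc (1 + (w + e))) (length-nest 2 (2 * r) (4 * r + 4) _)
           (cong₂ (λ e₂ e₁ → e₂ + (e₁ + (1 + 0))) (length-nest (2 * r + 2) r (2 * r + 3) _) (length-nest (3 * r + 2) r 1 _)) ⟩
    suc (1 + (2 * r + (r + (r + (1 + 0)))))
      ≡⟨ solve (r ∷ []) ⟩
    4 * r + 3
      ∎
    where open ≡-Reasoning

-- The code built from two pairings

OptimalOOC : ℕ → Set
OptimalOOC n = Σ (List (Block 3 n 3)) (λ C → IsOptimalOOC 3 n 3 C × ∣ C ∣ᶜ ≡ Θ₃₀₃ n)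

0≢1 : _≢_ {A = Fin 3} 0F 1F
0≢1 ()

1≢2 : _≢_ {A = Fin 3} 1F 2F
1≢2 ()

2≢0 : _≢_ {A = Fin 3} 2F 0F
2≢0 ()

module FromPairings {n h g G : ℕ} (n≡h+h : n ≡ h + h) (n≡G+g+g : n ≡ G + g + g) (0<g : 0 < g)
                    (P : Pairing n h g) (Q : Pairing n h G) where

  open Pairing

  G+g<n : G + g < n
  G+g<n = subst (G + g <_) (sym n≡G+g+g) (m<m+n (G + g) 0<g)

  G<n : G < n
  G<n = ≤-<-trans (m≤m+n G g) G+g<n

  0<n : 0 < n
  0<n = ≤-<-trans z≤n G<n

  o : Fin n
  o = fromℕ< 0<n

  lo<n : ∀ c → lo c < n
  lo<n c = <-trans (lo<hi c) (hi<n c)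

  loᶠ hiᶠ : Chord n → Fin n
  loᶠ c = fromℕ< (lo<n c)
  hiᶠ c = fromℕ< (hi<n c)

  loᶠ≢hiᶠ : ∀ c → loᶠ c ≢ hiᶠ c
  loᶠ≢hiᶠ c eq = <⇒≢ (lo<hi c) (trans (sym (toℕ-fromℕ< _)) (trans (cong toℕ eq) (toℕ-fromℕ< _)))

  row≢ : ∀ {a b : Fin 3} {x y : Fin n} → a ≢ b → (a , x) ≢ (b , y)
  row≢ a≢b = a≢b ∘ cong proj₁

  column≢ : ∀ {a : Fin 3} {x y : Fin n} → x ≢ y → (a , x) ≢ (a , y)
  column≢ x≢y = x≢y ∘ cong proj₂

  chordBlock : (r r′ : Fin 3) → r ≢ r′ → Chord n → Block 3 n 3
  chordBlock r r′ r≢r′ c = block ((r , loᶠ c) ∷ (r , hiᶠ c) ∷ (r′ , o) ∷ [])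
    (Unique-triple (column≢ (loᶠ≢hiᶠ c)) (row≢ r≢r′) (row≢ r≢r′)) refl

  transversal : Fin n → Fin n → Fin n → Block 3 n 3
  transversal x y z = block ((0F , x) ∷ (1F , y) ∷ (2F , z) ∷ [])
    (Unique-triple (row≢ 0≢1) (row≢ (2≢0 ∘ sym)) (row≢ 1≢2)) refl

  tA tB : Block 3 n 3
  tA = transversal o o o
  tB = transversal o (fromℕ< G+g<n) (fromℕ< G<n)

  codewords : List (Block 3 n 3)
  codewords = map (chordBlock 0F 1F 0≢1) (chords P) ++ map (chordBlock 1F 2F 1≢2) (chords P)
           ++ map (chordBlock 2F 0F 2≢0) (chords Q) ++ tA ∷ tB ∷ []

  P₀₁⊆ : ∀ {c} → c ∈ chords P → chordBlock 0F 1F 0≢1 c ∈ codewords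
  P₀₁⊆ c∈P = ∈-++⁺ˡ (∈-map⁺ _ c∈P)

  P₁₂⊆ : ∀ {c} → c ∈ chords P → chordBlock 1F 2F 1≢2 c ∈ codewords
  P₁₂⊆ c∈P = ∈-++⁺ʳ (map _ (chords P)) (∈-++⁺ˡ (∈-map⁺ _ c∈P))

  Q₂₀⊆ : ∀ {c} → c ∈ chords Q → chordBlock 2F 0F 2≢0 c ∈ codewords
  Q₂₀⊆ c∈Q = ∈-++⁺ʳ (map _ (chords P)) (∈-++⁺ʳ (map _ (chords P)) (∈-++⁺ˡ (∈-map⁺ _ c∈Q)))

  tA∈ : tA ∈ codewords
  tA∈ = ∈-++⁺ʳ (map _ (chords P)) (∈-++⁺ʳ (map _ (chords P)) (∈-++⁺ʳ (map _ (chords Q)) (here refl)))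

  tB∈ : tB ∈ codewords
  tB∈ = ∈-++⁺ʳ (map _ (chords P)) (∈-++⁺ʳ (map _ (chords P)) (∈-++⁺ʳ (map _ (chords Q)) (there (here refl))))

  module _ {r r′ : Fin 3} (r≢r′ : r ≢ r′) {cs : List (Chord n)}
           (cs⊆ : ∀ {c} → c ∈ cs → chordBlock r r′ r≢r′ c ∈ codewords) where

    touched∈Δ : ∀ {v} → Any (Touches v) cs → v ∈ Δ r r′ codewords
    touched∈Δ touched with find touched
    ... | c , c∈cs , inj₁ refl = subst (_∈ Δ r r′ codewords) (diffMod-fromℕ<-≤ (lo<n c) 0<n z≤n)
      (diffMod∈Δ (cs⊆ c∈cs) (here refl) (there (there (here refl))) (row≢ r≢r′))
    ... | c , c∈cs , inj₂ refl = subst (_∈ Δ r r′ codewords) (diffMod-fromℕ<-≤ (hi<n c) 0<n z≤n)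
      (diffMod∈Δ (cs⊆ c∈cs) (there (here refl)) (there (there (here refl))) (row≢ r≢r′))

    spanned∈Δ : ∀ {d} → Any (Spans d) cs → d ∈ Δ r r codewords
    spanned∈Δ spanned with find spanned
    ... | c , c∈cs , inj₁ refl = subst (_∈ Δ r r codewords) (diffMod-fromℕ<-≤ (hi<n c) (lo<n c) (<⇒≤ (lo<hi c)))
      (diffMod∈Δ (cs⊆ c∈cs) (there (here refl)) (here refl) (column≢ (loᶠ≢hiᶠ c ∘ sym)))
    ... | c , c∈cs , inj₂ refl = subst (_∈ Δ r r codewords) (diffMod-fromℕ<-< (lo<n c) (hi<n c) (lo<hi c))
      (diffMod∈Δ (cs⊆ c∈cs) (here refl) (there (here refl)) (column≢ (loᶠ≢hiᶠ c)))

  0∈Δ : ∀ {r r′} → r ≢ r′ → (r , o) ∈ pts tA → (r′ , o) ∈ pts tA → 0 ∈ Δ r r′ codewords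
  0∈Δ {r} {r′} r≢r′ p∈tA q∈tA =
    subst (_∈ Δ r r′ codewords) (diffMod-self o) (diffMod∈Δ tA∈ p∈tA q∈tA (row≢ r≢r′))

  g∈Δ₀₁ : g ∈ Δ 0F 1F codewords
  g∈Δ₀₁ = subst (_∈ Δ 0F 1F codewords) o-to-G+g (diffMod∈Δ tB∈ (here refl) (there (here refl)) (row≢ 0≢1))
    where
    o-to-G+g : diffMod o (fromℕ< G+g<n) ≡ g
    o-to-G+g = trans (diffMod-fromℕ<-< 0<n G+g<n (<-≤-trans 0<g (m≤n+m g G)))
                     (trans (cong (_∸ (G + g)) n≡G+g+g) (m+n∸m≡n (G + g) g))

  g∈Δ₁₂ : g ∈ Δ 1F 2F codewords
  g∈Δ₁₂ = subst (_∈ Δ 1F 2F codewords) (trans (diffMod-fromℕ<-≤ G+g<n G<n (m≤m+n G g)) (m+n∸m≡n G g))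
    (diffMod∈Δ tB∈ (there (here refl)) (there (there (here refl))) (row≢ 1≢2))

  G∈Δ₂₀ : G ∈ Δ 2F 0F codewords
  G∈Δ₂₀ = subst (_∈ Δ 2F 0F codewords) (diffMod-fromℕ<-≤ G<n 0<n z≤n)
    (diffMod∈Δ tB∈ (there (there (here refl))) (here refl) (row≢ 2≢0))

  off-diagonal : ∀ {r r′ cs hole} (r≢r′ : r ≢ r′) → (∀ {c} → c ∈ cs → chordBlock r r′ r≢r′ c ∈ codewords) →
                 0 ∈ Δ r r′ codewords → hole ∈ Δ r r′ codewords →
                 Covered (λ v → Any (Touches v) cs) 1 hole → Covered (λ v → Any (Touches v) cs) (suc hole) n →
                 Covered (_∈ Δ r r′ codewords) 0 n
  off-diagonal r≢r′ cs⊆ 0∈Δ hole∈Δ below above =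
    Covered-point 0∈Δ
      ⟫ Covered-map (touched∈Δ r≢r′ cs⊆) below ⟨ refl ⟩
      ⟫ Covered-point hole∈Δ ⟨ refl ⟩
      ⟫ Covered-map (touched∈Δ r≢r′ cs⊆) above ⟨ refl ⟩

  reversed : ∀ {i j} → Covered (_∈ Δ i j codewords) 0 n → Covered (_∈ Δ j i codewords) 0 n
  reversed {i} {j} cover v _ v<n = Δ-swap⁻ {i = i} {j = j} {C = codewords} v<n (cover _ z≤n (negateMod<n v<n))

  mirrored : ∀ {i} → Covered (_∈ Δ i i codewords) 1 h → Covered (_∈ Δ i i codewords) (suc h) n
  mirrored {i} cover (suc v) h<1+v 1+v<n = Δ-swap⁻ {i = i} {j = i} {C = codewords} 1+v<n
    (cover (n ∸ suc v) (m<n⇒0<n∸m 1+v<n) (subst (n ∸ suc v <_) (trans (cong (_∸ h) n≡h+h) (m+n∸n≡m h h))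
      (∸-monoʳ-< h<1+v (<⇒≤ 1+v<n))))

  diagonal : ∀ {r r′ cs} (r≢r′ : r ≢ r′) → (∀ {c} → c ∈ cs → chordBlock r r′ r≢r′ c ∈ codewords) →
             Covered (λ d → Any (Spans d) cs) 1 h → Covered (_∈ 0 ∷ h ∷ Δ r r codewords) 0 n
  diagonal {r} r≢r′ cs⊆ spanned =
    Covered-point (here refl)
      ⟫ Covered-map (there ∘ there) lower ⟨ refl ⟩
      ⟫ Covered-point (there (here refl)) ⟨ refl ⟩
      ⟫ Covered-map (there ∘ there) (mirrored lower) ⟨ refl ⟩
    where
    lower : Covered (_∈ Δ r r codewords) 1 h
    lower = Covered-map (spanned∈Δ r≢r′ cs⊆) spanned

  cover₀₁ : Covered (_∈ Δ 0F 1F codewords) 0 n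
  cover₀₁ = off-diagonal 0≢1 P₀₁⊆ (0∈Δ 0≢1 (here refl) (there (here refl))) g∈Δ₀₁
    (cells-below P) (cells-above P)

  cover₁₂ : Covered (_∈ Δ 1F 2F codewords) 0 n
  cover₁₂ = off-diagonal 1≢2 P₁₂⊆ (0∈Δ 1≢2 (there (here refl)) (there (there (here refl)))) g∈Δ₁₂
    (cells-below P) (cells-above P)

  cover₂₀ : Covered (_∈ Δ 2F 0F codewords) 0 n
  cover₂₀ = off-diagonal 2≢0 Q₂₀⊆ (0∈Δ 2≢0 (there (there (here refl))) (here refl)) G∈Δ₂₀
    (cells-below Q) (cells-above Q)

  -- 0 and h are the differences missing from each diagonal Δ_ii.
  pad : Fin 3 → Fin 3 → List ℕ
  pad i j = if does (i Fin.≟ j) then 0 ∷ h ∷ [] else []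

  covered : ∀ i j → Covered (_∈ pad i j ++ Δ i j codewords) 0 n
  covered 0F 0F = diagonal 0≢1 P₀₁⊆ (spans P)
  covered 1F 1F = diagonal 1≢2 P₁₂⊆ (spans P)
  covered 2F 2F = diagonal 2≢0 Q₂₀⊆ (spans Q)
  covered 0F 1F = cover₀₁
  covered 1F 2F = cover₁₂
  covered 2F 0F = cover₂₀
  covered 1F 0F = reversed cover₀₁
  covered 2F 1F = reversed cover₁₂
  covered 0F 2F = reversed cover₂₀

  suc-length-codewords : suc (length codewords) ≡ 3 * h
  suc-length-codewords = begin
    suc (length codewords)         ≡⟨ cong suc length≡ ⟩
    suc (p + (p + (q + 2)))        ≡⟨ arith p q ⟩
    suc p + (suc p + (suc q + 0))  ≡⟨ cong₂ (λ x y → x + (x + (y + 0))) (count P) (count Q) ⟩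
    3 * h                          ∎
    where
    open ≡-Reasoning
    p q : ℕ
    p = length (chords P)
    q = length (chords Q)
    arith : ∀ p q → suc (p + (p + (q + 2))) ≡ suc p + (suc p + (suc q + 0))
    arith = solve-∀
    length≡ : length codewords ≡ p + (p + (q + 2))
    length≡ = trans (length-++ (map _ (chords P)))
      (cong₂ _+_ (length-map _ (chords P)) (trans (length-++ (map _ (chords P)))
        (cong₂ _+_ (length-map _ (chords P)) (trans (length-++ (map _ (chords Q))) (cong (_+ 2) (length-map _ (chords Q)))))))

  six-times : suc (length codewords) * 6 ≡ 3 * (3 * n)
  six-times = begin
    suc (length codewords) * 6  ≡⟨ cong (_* 6) suc-length-codewords ⟩
    3 * h * 6                   ≡⟨ arith h ⟩
    3 * (3 * (h + h))           ≡⟨ cong (λ m → 3 * (3 * m)) n≡h+h ⟨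
    3 * (3 * n)                 ∎
    where
    open ≡-Reasoning
    arith : ∀ h → 3 * h * 6 ≡ 3 * (3 * (h + h))
    arith = solve-∀

  total-length : ∑∑ (λ i j → length (pad i j ++ Δ i j codewords)) ≡ 3 * (3 * n)
  total-length = begin
    ∑∑ (λ i j → length (pad i j ++ Δ i j codewords))  ≡⟨ ∑∑-length-++ pad (λ i j → Δ i j codewords) ⟩
    6 + ∑∑ (λ i j → length (Δ i j codewords))         ≡⟨ cong (6 +_) (∑∑-length-Δ codewords) ⟩
    suc (length codewords) * 6                        ≡⟨ six-times ⟩
    3 * (3 * n)                                       ∎
    where open ≡-Reasoning

  Δ-unique : ∀ i j → Unique (Δ i j codewords)
  Δ-unique i j = Unique-++⁻ʳ (pad i j)
    (covers-tight⇒Unique (λ i j → pad i j ++ Δ i j codewords) (λ i j → Covered⇒downFrom⊆ (covered i j))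
      (≤-reflexive total-length) i j)

  codewords-OOC : IsOOC 3 n 3 codewords
  codewords-OOC = record
    { distinct = Unique-Δ⇒distinct (s≤s (s≤s z≤n)) codewords Δ-unique
    ; diffs    = Δ-unique
    }

  codewords-optimal : ∀ D → IsOOC 3 n 3 D → length D ≤ length codewords
  codewords-optimal D D-OOC = ≤-pred (*-cancelʳ-< 6 (length D) (suc (length codewords)) (begin-strict
    length D * 6                 <⟨ m<m+n (length D * 6) (s≤s z≤n) ⟩
    length D * (3 * 2) + 3       ≤⟨ ooc-size-bound 0<n D-OOC ⟩
    3 * (3 * n)                  ≡⟨ six-times ⟨
    suc (length codewords) * 6   ∎))
    where open ≤-Reasoning

  Θ≡length : Θ₃₀₃ n ≡ length codewords
  Θ≡length = begin
    (9 * n ∸ 6) / 6                        ≡⟨ cong (λ x → (x ∸ 6) / 6) (trans (*-assoc 3 3 n) (sym six-times)) ⟩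
    (suc (length codewords) * 6 ∸ 6) / 6   ≡⟨ cong (_/ 6) (m+n∸m≡n 6 (length codewords * 6)) ⟩
    length codewords * 6 / 6               ≡⟨ m*n/n≡m (length codewords) 6 ⟩
    length codewords                       ∎
    where open ≡-Reasoning

  optimal-OOC : OptimalOOC n
  optimal-OOC = codewords , (codewords-OOC , codewords-optimal) , sym Θ≡length

optimal-OOC-8r+8 : ∀ {n} r → n ≡ 8 * r + 8 → OptimalOOC n
optimal-OOC-8r+8 {n} r n≡ = FromPairings.optimal-OOC {n} {4 * r + 4} {2 * r + 1 + 1} {4 * r + 4}
  n≡h+h n≡G+g+g (m≤n+m 1 (2 * r + 1)) P (pairing-8r+8 r n≡)
  where
  n≡h+h : n ≡ (4 * r + 4) + (4 * r + 4)
  n≡h+h = trans n≡ (solve (r ∷ []))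
  n≡G+g+g : n ≡ (4 * r + 4) + (2 * r + 1 + 1) + (2 * r + 1 + 1)
  n≡G+g+g = trans n≡ (solve (r ∷ []))
  h≡ : suc (2 * r + 1 + (2 * r + 2)) ≡ 4 * r + 4
  h≡ = solve (r ∷ [])
  skolem-n≡ : n ≡ 2 * r + 2 + (2 * r + 2 + (2 * r + 1 + (1 + (2 * r + 1 + 1))))
  skolem-n≡ = trans n≡ (solve (r ∷ []))
  P : Pairing n (4 * r + 4) (2 * r + 1 + 1)
  P = subst (λ h → Pairing n h (2 * r + 1 + 1)) h≡
    (skolem-pairing (2 * r + 2) (2 * r + 1) (+-monoʳ-≤ (2 * r) (s≤s z≤n)) (≤-reflexive (+-suc (2 * r) 1)) skolem-n≡)

optimal-OOC-8r+6 : ∀ {n} r → n ≡ 8 * r + 6 → OptimalOOC n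
optimal-OOC-8r+6 {n} r n≡ = FromPairings.optimal-OOC {n} {4 * r + 3} {2 * r + 1 + 1} {4 * r + 2}
  n≡h+h n≡G+g+g (m≤n+m 1 (2 * r + 1)) P (pairing-8r+6 r n≡)
  where
  n≡h+h : n ≡ (4 * r + 3) + (4 * r + 3)
  n≡h+h = trans n≡ (solve (r ∷ []))
  n≡G+g+g : n ≡ (4 * r + 2) + (2 * r + 1 + 1) + (2 * r + 1 + 1)
  n≡G+g+g = trans n≡ (solve (r ∷ []))
  h≡ : suc (2 * r + 1 + (2 * r + 1)) ≡ 4 * r + 3
  h≡ = solve (r ∷ [])
  skolem-n≡ : n ≡ 2 * r + 1 + (2 * r + 1 + (2 * r + 1 + (1 + (2 * r + 1 + 1))))
  skolem-n≡ = trans n≡ (solve (r ∷ []))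
  P : Pairing n (4 * r + 3) (2 * r + 1 + 1)
  P = subst (λ h → Pairing n h (2 * r + 1 + 1)) h≡ (skolem-pairing (2 * r + 1) (2 * r + 1) ≤-refl (n≤1+n _) skolem-n≡)

n%8≡0⇒n≡8r+8 : ∀ {n} → n > 0 → n % 8 ≡ 0 → ∃[ r ] n ≡ 8 * r + 8
n%8≡0⇒n≡8r+8 {n} n>0 n%8≡0 with n / 8 | m≡m%n+[m/n]*n n 8
... | zero  | n≡ = ⊥-elim (<⇒≢ n>0 (sym (trans n≡ (cong (_+ 0) n%8≡0))))
... | suc r | n≡ = r , trans n≡ (trans (cong (_+ suc r * 8) n%8≡0) (solve (r ∷ [])))

n%8≡6⇒n≡8r+6 : ∀ {n} → n % 8 ≡ 6 → ∃[ r ] n ≡ 8 * r + 6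
n%8≡6⇒n≡8r+6 {n} n%8≡6 = n / 8 , trans (m≡m%n+[m/n]*n n 8)
  (trans (cong (_+ n / 8 * 8) n%8≡6) (trans (+-comm 6 (n / 8 * 8)) (cong (_+ 6) (*-comm (n / 8) 8))))

lemma7p5 : ∀ (n : ℕ) → n > 0 → (n % 8 ≡ 0 ⊎ n % 8 ≡ 6) →
    Σ (List (Block 3 n 3)) (λ C → IsOptimalOOC 3 n 3 C × ∣ C ∣ᶜ ≡ Θ₃₀₃ n)
lemma7p5 n n>0 (inj₁ n%8≡0) = let r , n≡ = n%8≡0⇒n≡8r+8 n>0 n%8≡0 in optimal-OOC-8r+8 r n≡
lemma7p5 n _   (inj₂ n%8≡6) = let r , n≡ = n%8≡6⇒n≡8r+6 n%8≡6 in optimal-OOC-8r+6 r n≡
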